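{- Let $n\in\mathbb N$. (a) If $4\mid n$, then $$\sum_{k=0}^n\binom nk\binom{2k}{k}\frac{u_k(2,2)}{(-4)^k}=0.$$ (b) If $n\equiv2\pmod 4$, then $$\sum_{k=0}^n\binom nk\binom{2k}{k}\frac{v_k(2,2)}{(-4)^k}=0.$$
   Context: For integers $A,B$, the Lucas sequences are defined by $u_0=0$, $u_1=1$, $u_{n+1}=Au_n-Bu_{n-1}$ and $v_0=2$, $v_1=A$, $v_{n+1}=Av_n-Bv_{n-1}$ for $n\ge1$; here $u_k(A,B),v_k(A,B)$ denote these sequences. -}

module Defs where

open import Data.Nat as ℕ using (ℕ; zero; suc)
open import Data.Integer as ℤ using (ℤ; +_)
open import Data.Rational as Q using (ℚ)
import Data.Nat.Properties as ℕP

lucasU : ℤ → ℤ → ℕ → ℤ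
lucasU A B zero = + 0
lucasU A B (suc zero) = + 1
lucasU A B (suc (suc n)) = A ℤ.* lucasU A B (suc n) ℤ.- B ℤ.* lucasU A B n

lucasV : ℤ → ℤ → ℕ → ℤ
lucasV A B zero = + 2
lucasV A B (suc zero) = A
lucasV A B (suc (suc n)) = A ℤ.* lucasV A B (suc n) ℤ.- B ℤ.* lucasV A B n

sumTo : ℕ → (ℕ → ℚ) → ℚ
sumTo zero f = f 0
sumTo (suc n) f = sumTo n f Q.+ f (suc n)

-- x / (-4)^k  as a rational number, for an integer x
-- (written as ((-1)^k * x) / 4^k, which is the same rational)
divNeg4Pow : ℤ → ℕ → ℚ
divNeg4Pow x k = Q._/_ ((ℤ.- (+ 1)) ℤ.^ k ℤ.* x) (4 ℕ.^ k) {{ℕP.m^n≢0 4 k}}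

module Submission where

-- Let Fₓ(n) = Σ_{k≤n} C(n,k) C(2k,k) xᵏ.  A creative-telescoping certificate shows,
-- in any commutative ring, the three-term recurrence
--     (n+2) Fₓ(n+2) + (n+1)(1+4x) Fₓ(n) = (2n+3)(1+2x) Fₓ(n+1).
-- Take x = z = -(1+i)/4 in the Gaussian rationals ℚ(i).  Then 1+2z = ω/2 and 1+4z = ω²/2 with
-- ω = 1 − i, so by induction Fz(n) is a real multiple of ωⁿ.  Since ω⁴ = -4 and ω² = -2i,
-- Fz(4j) is real and Fz(4j+2) is purely imaginary.  Finally α = 1+i is a root of X² − 2X + 2, so
-- αᵏ = vₖ/2 + uₖ i (Binet) and zᵏ = (-1/4)ᵏ αᵏ; hence the sums (a) and (b) of the theorem are
-- Im Fz(n) and 2 Re Fz(n), which vanish for n = 4j and n = 4j + 2 respectively.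

open import Algebra.Bundles using (CommutativeRing)

module Binomial where

  open import Data.Nat using (ℕ; zero; suc; _+_; _*_)
  open import Data.Nat.Properties using (*-zeroʳ; +-identityʳ; *-identityˡ; *-identityʳ; +-cancelʳ-≡)
  open import Data.Nat.Combinatorics using (_C_; nCk+nC[k+1]≡[n+1]C[k+1]; nC1≡n)
  open import Data.Nat.Solver using (module +-*-Solver)
  open import Relation.Binary.PropositionalEquality using (_≡_; refl; sym; trans; cong; cong₂; module ≡-Reasoning)
  open +-*-Solver
  open ≡-Reasoning

  central : ℕ → ℕ
  central k = (2 * k) C k

  pascal : ∀ n k → suc n C suc k ≡ n C k + n C suc k
  pascal n k = sym (nCk+nC[k+1]≡[n+1]C[k+1] n k)

  absorption : ∀ n k → suc k * (suc n C suc k) ≡ suc n * (n C k)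
  absorption zero    zero    = refl
  absorption zero    (suc k) = *-zeroʳ (suc (suc k))
  absorption (suc n) zero    = begin
    1 * (suc (suc n) C 1)      ≡⟨ *-identityˡ _ ⟩
    suc (suc n) C 1            ≡⟨ nC1≡n (suc (suc n)) ⟩
    suc (suc n)                ≡⟨ sym (*-identityʳ (suc (suc n))) ⟩
    suc (suc n) * 1            ∎
  absorption (suc n) (suc k) = begin
    suc (suc k) * (suc (suc n) C suc (suc k))
      ≡⟨ cong (suc (suc k) *_) (pascal (suc n) (suc k)) ⟩
    suc (suc k) * (a + b)
      ≡⟨ solve 3 (λ k a b → (con 2 :+ k) :* (a :+ b) := (con 1 :+ k) :* a :+ a :+ (con 2 :+ k) :* b) refl k a b ⟩
    suc k * a + a + suc (suc k) * b
      ≡⟨ cong₂ (λ u v → u + a + v) (absorption n k) (absorption n (suc k)) ⟩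
    suc n * (n C k) + a + suc n * (n C suc k)
      ≡⟨ solve 4 (λ n c d a → (con 1 :+ n) :* c :+ a :+ (con 1 :+ n) :* d := (con 1 :+ n) :* (c :+ d) :+ a) refl n (n C k) (n C suc k) a ⟩
    suc n * (n C k + n C suc k) + a
      ≡⟨ cong (λ u → suc n * u + a) (sym (pascal n k)) ⟩
    suc n * a + a
      ≡⟨ solve 2 (λ n a → (con 1 :+ n) :* a :+ a := (con 2 :+ n) :* a) refl n a ⟩
    suc (suc n) * a
      ∎
    where
    a = suc n C suc k
    b = suc n C suc (suc k)

  absorption-split : ∀ n k → suc n * (n C k) + k * (suc n C k) ≡ suc n * (suc n C k)
  absorption-split n zero    = +-identityʳ _
  absorption-split n (suc k) = begin
    suc n * (n C suc k) + suc k * (suc n C suc k)  ≡⟨ cong (suc n * (n C suc k) +_) (absorption n k) ⟩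
    suc n * (n C suc k) + suc n * (n C k)          ≡⟨ solve 3 (λ n a b → (con 1 :+ n) :* b :+ (con 1 :+ n) :* a := (con 1 :+ n) :* (a :+ b)) refl n (n C k) (n C suc k) ⟩
    suc n * (n C k + n C suc k)                    ≡⟨ cong (suc n *_) (sym (pascal n k)) ⟩
    suc n * (suc n C suc k)                        ∎

  central-step : ∀ k → suc k * central (suc k) ≡ 2 * suc (2 * k) * central k
  central-step k = begin
    suc k * (2 * suc k C suc k)             ≡⟨ cong (λ m → suc k * (m C suc k)) (solve 1 (λ k → con 2 :* (con 1 :+ k) := con 2 :+ con 2 :* k) refl k) ⟩
    suc k * (suc (suc (2 * k)) C suc k)     ≡⟨ absorption (suc (2 * k)) k ⟩
    suc (suc (2 * k)) * (suc (2 * k) C k)   ≡⟨ solve 2 (λ k c → (con 2 :+ con 2 :* k) :* c := con 2 :* ((con 1 :+ k) :* c)) refl k (suc (2 * k) C k) ⟩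
    2 * (suc k * (suc (2 * k) C k))         ≡⟨ cong (2 *_) half ⟩
    2 * (suc (2 * k) * central k)           ≡⟨ solve 2 (λ k c → con 2 :* ((con 1 :+ con 2 :* k) :* c) := con 2 :* (con 1 :+ con 2 :* k) :* c) refl k (central k) ⟩
    2 * suc (2 * k) * central k             ∎
    where
    -- (k+1) C(2k+1, k) = (2k+1) C(2k, k): absorption-split at n = 2k, cancelling k C(2k+1, k).
    half : suc k * (suc (2 * k) C k) ≡ suc (2 * k) * central k
    half = +-cancelʳ-≡ (k * (suc (2 * k) C k)) _ _ (begin
      suc k * (suc (2 * k) C k) + k * (suc (2 * k) C k)   ≡⟨ solve 2 (λ k c → (con 1 :+ k) :* c :+ k :* c := (con 1 :+ con 2 :* k) :* c) refl k (suc (2 * k) C k) ⟩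
      suc (2 * k) * (suc (2 * k) C k)                     ≡⟨ sym (absorption-split (2 * k) k) ⟩
      suc (2 * k) * central k + k * (suc (2 * k) C k)     ∎)

  -- Coefficient of the WZ-type certificate for the sums Σₖ C(n,k) C(2k,k) xᵏ:
  -- certificate n k = k C(n+1, k-1).
  certificate : ℕ → ℕ → ℕ
  certificate n zero    = 0
  certificate n (suc k) = suc k * (suc n C k)

  certificate-step : ∀ n k → certificate n (suc k) * central (suc k) ≡ (suc n C k) * (2 * suc (2 * k)) * central k
  certificate-step n k = begin
    suc k * b * central (suc k)          ≡⟨ solve 3 (λ k b c → (con 1 :+ k) :* b :* c := b :* ((con 1 :+ k) :* c)) refl k b (central (suc k)) ⟩
    b * (suc k * central (suc k))        ≡⟨ cong (b *_) (central-step k) ⟩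
    b * (2 * suc (2 * k) * central k)    ≡⟨ solve 3 (λ b m c → b :* (m :* c) := b :* m :* c) refl b (2 * suc (2 * k)) (central k) ⟩
    b * (2 * suc (2 * k)) * central k    ∎
    where b = suc n C k

  -- Coefficient of xᵏ in the telescoping identity.
  coefficient-identity₀ : ∀ n k →
    (2 + n) * ((2 + n) C k) + (1 + n) * (n C k) ≡ (3 + 2 * n) * (suc n C k) + certificate n k
  coefficient-identity₀ n zero    = solve 1 (λ n → (con 2 :+ n) :* con 1 :+ (con 1 :+ n) :* con 1 := (con 3 :+ con 2 :* n) :* con 1 :+ con 0) refl n
  coefficient-identity₀ n (suc k) = begin
    (2 + n) * ((2 + n) C suc k) + (1 + n) * a
      ≡⟨ cong (λ u → (2 + n) * u + (1 + n) * a) (trans (pascal (suc n) k) (cong (e +_) (pascal n k))) ⟩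
    (2 + n) * (e + (f + a)) + (1 + n) * a
      ≡⟨ solve 4 (λ n e f a → (con 2 :+ n) :* (e :+ (f :+ a)) :+ (con 1 :+ n) :* a
                             := (con 1 :+ n) :* e :+ (e :+ (con 2 :+ n) :* f :+ (con 3 :+ con 2 :* n) :* a)) refl n e f a ⟩
    suc n * e + rest
      ≡⟨ cong (_+ rest) (sym (absorption-split n k)) ⟩
    (suc n * f + k * e) + rest
      ≡⟨ solve 5 (λ n k e f a → ((con 1 :+ n) :* f :+ k :* e) :+ (e :+ (con 2 :+ n) :* f :+ (con 3 :+ con 2 :* n) :* a)
                               := (con 3 :+ con 2 :* n) :* (f :+ a) :+ (con 1 :+ k) :* e) refl n k e f a ⟩
    (3 + 2 * n) * (f + a) + suc k * e
      ≡⟨ cong (λ u → (3 + 2 * n) * u + suc k * e) (sym (pascal n k)) ⟩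
    (3 + 2 * n) * (suc n C suc k) + suc k * e
      ∎
    where
    a = n C suc k
    e = suc n C k
    f = n C k
    rest = e + (2 + n) * f + (3 + 2 * n) * a

  -- Coefficient of xᵏ⁺¹ in the telescoping identity (after dividing out C(2k,k)).
  coefficient-identity₁ : ∀ n k →
    4 * (1 + n) * (n C k) + 2 * suc (2 * k) * (suc n C k) ≡ 2 * (3 + 2 * n) * (suc n C k)
  coefficient-identity₁ n k = begin
    4 * (1 + n) * a + 2 * suc (2 * k) * b
      ≡⟨ solve 4 (λ n k a b → con 4 :* (con 1 :+ n) :* a :+ con 2 :* (con 1 :+ con 2 :* k) :* b
                             := con 4 :* ((con 1 :+ n) :* a :+ k :* b) :+ con 2 :* b) refl n k a b ⟩
    4 * (suc n * a + k * b) + 2 * b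
      ≡⟨ cong (λ u → 4 * u + 2 * b) (absorption-split n k) ⟩
    4 * (suc n * b) + 2 * b
      ≡⟨ solve 2 (λ n b → con 4 :* ((con 1 :+ n) :* b) :+ con 2 :* b := con 2 :* (con 3 :+ con 2 :* n) :* b) refl n b ⟩
    2 * (3 + 2 * n) * b
      ∎
    where
    a = n C k
    b = suc n C k


module CentralBinomialSums {ℓ₁ ℓ₂} (R : CommutativeRing ℓ₁ ℓ₂) where

  open import Data.Nat as ℕ using (ℕ; zero; suc)
  import Data.Nat.Properties as ℕP
  open import Data.Nat.Combinatorics using (_C_; k>n⇒nCk≡0)
  import Relation.Binary.PropositionalEquality as ≡
  open CommutativeRing R
  open import Algebra.Properties.Semiring.Mult semiring using (_×_; ×-homo-+; ×1-homo-*)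
  open import Algebra.Properties.Semiring.Exp semiring using (_^_)
  open import Algebra.Properties.Group +-group using (∙-cancelʳ)
  open import Algebra.Solver.Ring.NaturalCoefficients.Default commutativeSemiring using (solve; _:=_; _:+_; _:*_; con)
  open import Relation.Binary.Reasoning.Setoid setoid
  open Binomial

  ι : ℕ → Carrier
  ι n = n × 1#

  ι-+ : ∀ m n → ι (m ℕ.+ n) ≈ ι m + ι n
  ι-+ = ×-homo-+ 1#

  ι-* : ∀ m n → ι (m ℕ.* n) ≈ ι m * ι n
  ι-* = ×1-homo-*

  ι-cong : ∀ {m n} → m ≡.≡ n → ι m ≈ ι n
  ι-cong ≡.refl = refl

  Σ≤ : ℕ → (ℕ → Carrier) → Carrier
  Σ≤ zero    f = f 0
  Σ≤ (suc n) f = Σ≤ n f + f (suc n)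

  Σ≤-cong : ∀ n {f g} → (∀ k → f k ≈ g k) → Σ≤ n f ≈ Σ≤ n g
  Σ≤-cong zero    f≈g = f≈g 0
  Σ≤-cong (suc n) f≈g = +-cong (Σ≤-cong n f≈g) (f≈g (suc n))

  Σ≤-+ : ∀ n f g → Σ≤ n (λ k → f k + g k) ≈ Σ≤ n f + Σ≤ n g
  Σ≤-+ zero    f g = refl
  Σ≤-+ (suc n) f g = begin
    Σ≤ n (λ k → f k + g k) + (f (suc n) + g (suc n))  ≈⟨ +-congʳ (Σ≤-+ n f g) ⟩
    (Σ≤ n f + Σ≤ n g) + (f (suc n) + g (suc n))       ≈⟨ solve 4 (λ a b c d → (a :+ b) :+ (c :+ d) := (a :+ c) :+ (b :+ d)) refl (Σ≤ n f) (Σ≤ n g) (f (suc n)) (g (suc n)) ⟩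
    (Σ≤ n f + f (suc n)) + (Σ≤ n g + g (suc n))       ∎

  Σ≤-*ˡ : ∀ n a f → Σ≤ n (λ k → a * f k) ≈ a * Σ≤ n f
  Σ≤-*ˡ zero    a f = refl
  Σ≤-*ˡ (suc n) a f = trans (+-congʳ (Σ≤-*ˡ n a f)) (sym (distribˡ a (Σ≤ n f) (f (suc n))))

  Σ≤-drop-last : ∀ n f → f (suc n) ≈ 0# → Σ≤ (suc n) f ≈ Σ≤ n f
  Σ≤-drop-last n f f[n+1]≈0 = trans (+-congˡ f[n+1]≈0) (+-identityʳ (Σ≤ n f))

  Σ≤-shift : ∀ n g → Σ≤ n (λ k → g (suc k)) + g 0 ≈ Σ≤ n g + g (suc n)
  Σ≤-shift zero    g = +-comm (g 1) (g 0)
  Σ≤-shift (suc n) g = begin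
    (Σ≤ n (λ k → g (suc k)) + g (2 ℕ.+ n)) + g 0  ≈⟨ solve 3 (λ a b c → (a :+ b) :+ c := (a :+ c) :+ b) refl (Σ≤ n (λ k → g (suc k))) (g (2 ℕ.+ n)) (g 0) ⟩
    (Σ≤ n (λ k → g (suc k)) + g 0) + g (2 ℕ.+ n)  ≈⟨ +-congʳ (Σ≤-shift n g) ⟩
    (Σ≤ n g + g (suc n)) + g (2 ℕ.+ n)            ∎

  Σ≤-telescope : ∀ n g → g 0 ≈ 0# → g (suc n) ≈ 0# → Σ≤ n (λ k → g (suc k)) ≈ Σ≤ n g
  Σ≤-telescope n g g0≈0 g[n+1]≈0 = begin
    Σ≤ n (λ k → g (suc k))           ≈⟨ sym (+-identityʳ _) ⟩
    Σ≤ n (λ k → g (suc k)) + 0#      ≈⟨ +-congˡ (sym g0≈0) ⟩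
    Σ≤ n (λ k → g (suc k)) + g 0     ≈⟨ Σ≤-shift n g ⟩
    Σ≤ n g + g (suc n)               ≈⟨ +-congˡ g[n+1]≈0 ⟩
    Σ≤ n g + 0#                      ≈⟨ +-identityʳ _ ⟩
    Σ≤ n g                           ∎

  T : Carrier → ℕ → Carrier
  T x k = ι (central k) * x ^ k

  F : Carrier → ℕ → Carrier
  F x n = Σ≤ n (λ k → ι (n C k) * T x k)

  G : Carrier → ℕ → ℕ → Carrier
  G x n k = ι (certificate n k) * T x k

  ι[nCk]*T≈0 : ∀ x n k → n ℕ.< k → ι (n C k) * T x k ≈ 0#
  ι[nCk]*T≈0 x n k n<k = trans (*-congʳ (ι-cong (k>n⇒nCk≡0 n<k))) (zeroˡ (T x k))

  F-extend : ∀ x n → Σ≤ (2 ℕ.+ n) (λ k → ι (n C k) * T x k) ≈ F x n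
  F-extend x n =
    trans (Σ≤-drop-last (suc n) _ (ι[nCk]*T≈0 x n (2 ℕ.+ n) (ℕP.m<n⇒m<1+n (ℕP.n<1+n n))))
          (Σ≤-drop-last n _ (ι[nCk]*T≈0 x n (suc n) (ℕP.n<1+n n)))

  -- The certificate at k+1, expressed through Tₓ(k) (uses C(2k+2,k+1) = 2(2k+1)C(2k,k)/(k+1)).
  G-suc : ∀ x n k → G x n (suc k) ≈ ι (suc n C k) * ι (2 ℕ.* suc (2 ℕ.* k)) * (x * T x k)
  G-suc x n k = begin
    ι (certificate n (suc k)) * (ι (central (suc k)) * (x * x ^ k))
      ≈⟨ solve 3 (λ a b y → a :* (b :* y) := (a :* b) :* y) refl (ι (certificate n (suc k))) (ι (central (suc k))) (x * x ^ k) ⟩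
    (ι (certificate n (suc k)) * ι (central (suc k))) * (x * x ^ k)
      ≈⟨ *-congʳ (sym (ι-* (certificate n (suc k)) (central (suc k)))) ⟩
    ι (certificate n (suc k) ℕ.* central (suc k)) * (x * x ^ k)
      ≈⟨ *-congʳ (ι-cong (certificate-step n k)) ⟩
    ι ((suc n C k) ℕ.* (2 ℕ.* suc (2 ℕ.* k)) ℕ.* central k) * (x * x ^ k)
      ≈⟨ *-congʳ (trans (ι-* ((suc n C k) ℕ.* (2 ℕ.* suc (2 ℕ.* k))) (central k)) (*-congʳ (ι-* (suc n C k) (2 ℕ.* suc (2 ℕ.* k))))) ⟩
    ι (suc n C k) * ι (2 ℕ.* suc (2 ℕ.* k)) * ι (central k) * (x * x ^ k)
      ≈⟨ solve 5 (λ a b c x y → a :* b :* c :* (x :* y) := a :* b :* (x :* (c :* y))) refl (ι (suc n C k)) (ι (2 ℕ.* suc (2 ℕ.* k))) (ι (central k)) x (x ^ k) ⟩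
    ι (suc n C k) * ι (2 ℕ.* suc (2 ℕ.* k)) * (x * T x k)
      ∎

  -- Comparing coefficients of xᵏ and xᵏ⁺¹ reduces it to the two binomial coefficient identities.
  summand-identity : ∀ x n k →
    ι (2 ℕ.+ n) * (ι ((2 ℕ.+ n) C k) * T x k) + ι (1 ℕ.+ n) * (1# + ι 4 * x) * (ι (n C k) * T x k) + G x n (suc k)
    ≈ ι (3 ℕ.+ 2 ℕ.* n) * (1# + ι 2 * x) * (ι (suc n C k) * T x k) + G x n k
  summand-identity x n k = begin
    ι n₂ * (ι c * t) + ι n₁ * (1# + ι 4 * x) * (ι a * t) + G x n (suc k)
      ≈⟨ +-congˡ (G-suc x n k) ⟩
    ι n₂ * (ι c * t) + ι n₁ * (1# + ι 4 * x) * (ι a * t) + ι b * ι m * (x * t)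
      ≈⟨ solve 9 (λ n₂ c n₁ four x a t b m →
                    n₂ :* (c :* t) :+ n₁ :* (con 1 :+ four :* x) :* (a :* t) :+ b :* m :* (x :* t)
                 := (n₂ :* c :+ n₁ :* a) :* t :+ (four :* n₁ :* a :+ m :* b) :* (x :* t))
                 refl (ι n₂) (ι c) (ι n₁) (ι 4) x (ι a) t (ι b) (ι m) ⟩
    (ι n₂ * ι c + ι n₁ * ι a) * t + (ι 4 * ι n₁ * ι a + ι m * ι b) * (x * t)
      ≈⟨ +-cong (*-congʳ (sym ι-coefficient₀)) (*-congʳ (sym ι-coefficient₁)) ⟩
    ι (n₂ ℕ.* c ℕ.+ n₁ ℕ.* a) * t + ι (4 ℕ.* n₁ ℕ.* a ℕ.+ m ℕ.* b) * (x * t)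
      ≈⟨ +-cong (*-congʳ (ι-cong (coefficient-identity₀ n k))) (*-congʳ (ι-cong (coefficient-identity₁ n k))) ⟩
    ι (n₃ ℕ.* b ℕ.+ d) * t + ι (2 ℕ.* n₃ ℕ.* b) * (x * t)
      ≈⟨ +-cong (*-congʳ (trans (ι-+ (n₃ ℕ.* b) d) (+-congʳ (ι-* n₃ b))))
                (*-congʳ (trans (ι-* (2 ℕ.* n₃) b) (*-congʳ (ι-* 2 n₃)))) ⟩
    (ι n₃ * ι b + ι d) * t + ι 2 * ι n₃ * ι b * (x * t)
      ≈⟨ solve 6 (λ n₃ b d two x t →
                    (n₃ :* b :+ d) :* t :+ two :* n₃ :* b :* (x :* t)
                 := n₃ :* (con 1 :+ two :* x) :* (b :* t) :+ d :* t)
                 refl (ι n₃) (ι b) (ι d) (ι 2) x t ⟩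
    ι n₃ * (1# + ι 2 * x) * (ι b * t) + G x n k
      ∎
    where
    n₁ = 1 ℕ.+ n
    n₂ = 2 ℕ.+ n
    n₃ = 3 ℕ.+ 2 ℕ.* n
    a  = n C k
    b  = suc n C k
    c  = n₂ C k
    d  = certificate n k
    m  = 2 ℕ.* suc (2 ℕ.* k)
    t  = T x k
    ι-coefficient₀ : ι (n₂ ℕ.* c ℕ.+ n₁ ℕ.* a) ≈ ι n₂ * ι c + ι n₁ * ι a
    ι-coefficient₀ = trans (ι-+ (n₂ ℕ.* c) (n₁ ℕ.* a)) (+-cong (ι-* n₂ c) (ι-* n₁ a))
    ι-coefficient₁ : ι (4 ℕ.* n₁ ℕ.* a ℕ.+ m ℕ.* b) ≈ ι 4 * ι n₁ * ι a + ι m * ι b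
    ι-coefficient₁ = trans (ι-+ (4 ℕ.* n₁ ℕ.* a) (m ℕ.* b))
                           (+-cong (trans (ι-* (4 ℕ.* n₁) a) (*-congʳ (ι-* 4 n₁))) (ι-* m b))

  -- The three-term recurrence (n+2) Fₓ(n+2) + (n+1)(1+4x) Fₓ(n) = (2n+3)(1+2x) Fₓ(n+1):
  -- sum the summand identity over 0 ≤ k ≤ n+2; the certificate telescopes away.
  recurrence : ∀ x n → ι (2 ℕ.+ n) * F x (2 ℕ.+ n) + ι (1 ℕ.+ n) * (1# + ι 4 * x) * F x n
                      ≈ ι (3 ℕ.+ 2 ℕ.* n) * (1# + ι 2 * x) * F x (1 ℕ.+ n)
  recurrence x n = ∙-cancelʳ (Σ≤ n₂ (G x n)) _ _ (begin
    ι n₂ * F x n₂ + ι n₁ * c₄ * F x n + Σ≤ n₂ (G x n)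
      ≈⟨ +-cong (+-congˡ (*-congˡ (sym (F-extend x n)))) (sym (Σ≤-telescope n₂ (G x n) G-first G-last)) ⟩
    ι n₂ * Σ≤ n₂ (u n₂) + ι n₁ * c₄ * Σ≤ n₂ (u n) + Σ≤ n₂ (λ k → G x n (suc k))
      ≈⟨ +-congʳ (sym (trans (Σ≤-+ n₂ (λ k → ι n₂ * u n₂ k) (λ k → ι n₁ * c₄ * u n k))
                             (+-cong (Σ≤-*ˡ n₂ (ι n₂) (u n₂)) (Σ≤-*ˡ n₂ (ι n₁ * c₄) (u n))))) ⟩
    Σ≤ n₂ (λ k → ι n₂ * u n₂ k + ι n₁ * c₄ * u n k) + Σ≤ n₂ (λ k → G x n (suc k))
      ≈⟨ sym (Σ≤-+ n₂ (λ k → ι n₂ * u n₂ k + ι n₁ * c₄ * u n k) (λ k → G x n (suc k))) ⟩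
    Σ≤ n₂ (λ k → ι n₂ * u n₂ k + ι n₁ * c₄ * u n k + G x n (suc k))
      ≈⟨ Σ≤-cong n₂ (summand-identity x n) ⟩
    Σ≤ n₂ (λ k → ι n₃ * c₂ * u n₁ k + G x n k)
      ≈⟨ Σ≤-+ n₂ (λ k → ι n₃ * c₂ * u n₁ k) (G x n) ⟩
    Σ≤ n₂ (λ k → ι n₃ * c₂ * u n₁ k) + Σ≤ n₂ (G x n)
      ≈⟨ +-congʳ (trans (Σ≤-*ˡ n₂ (ι n₃ * c₂) (u n₁))
                        (*-congˡ (Σ≤-drop-last n₁ (u n₁) (ι[nCk]*T≈0 x n₁ n₂ (ℕP.n<1+n n₁))))) ⟩
    ι n₃ * c₂ * F x n₁ + Σ≤ n₂ (G x n)
      ∎)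
    where
    n₁ = 1 ℕ.+ n
    n₂ = 2 ℕ.+ n
    n₃ = 3 ℕ.+ 2 ℕ.* n
    c₂ = 1# + ι 2 * x
    c₄ = 1# + ι 4 * x
    u : ℕ → ℕ → Carrier
    u m k = ι (m C k) * T x k
    G-first : G x n 0 ≈ 0#
    G-first = zeroˡ (T x 0)
    -- certificate n (n+3) = (n+3) C(n+1, n+2) = 0
    G-last : G x n (suc n₂) ≈ 0#
    G-last = trans (*-congʳ (ι-cong (≡.trans (≡.cong (suc n₂ ℕ.*_) (k>n⇒nCk≡0 (ℕP.n<1+n n₁))) (ℕP.*-zeroʳ (suc n₂)))))
                   (zeroˡ (T x (suc n₂)))


module IntegersInRationals where

  open import Defs using (divNeg4Pow)
  open import Data.Nat as ℕ using (zero; suc)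
  import Data.Nat.Properties as ℕP
  open import Data.Integer as ℤ using (ℤ; +_; -[1+_])
  import Data.Integer.Properties as ℤP
  open import Data.Integer.Solver using (module +-*-Solver)
  open import Data.Rational as Q using (ℚ; _/_)
  import Data.Rational.Properties as QP
  open import Data.Rational.Unnormalised as U using (mkℚᵘ; *≡*)
  import Data.Rational.Unnormalised.Properties as UP
  import Data.Rational.Solver
  open import Algebra.Properties.Semiring.Exp (CommutativeRing.semiring QP.+-*-commutativeRing) using (_^_)
  open import Relation.Binary.PropositionalEquality using (_≡_; refl; sym; trans; cong; module ≡-Reasoning)
  module QS = Data.Rational.Solver.+-*-Solver
  open +-*-Solver using (solve; _:=_; _:+_; _:*_; con)

  fromℚᵘ-homo-+ : ∀ p q → Q.fromℚᵘ (p U.+ q) ≡ Q.fromℚᵘ p Q.+ Q.fromℚᵘ q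
  fromℚᵘ-homo-+ p q = QP.toℚᵘ-injective
    (UP.≃-trans (QP.toℚᵘ-fromℚᵘ (p U.+ q))
    (UP.≃-trans (UP.+-cong (UP.≃-sym (QP.toℚᵘ-fromℚᵘ p)) (UP.≃-sym (QP.toℚᵘ-fromℚᵘ q)))
                (UP.≃-sym (QP.toℚᵘ-homo-+ (Q.fromℚᵘ p) (Q.fromℚᵘ q)))))

  fromℚᵘ-homo-* : ∀ p q → Q.fromℚᵘ (p U.* q) ≡ Q.fromℚᵘ p Q.* Q.fromℚᵘ q
  fromℚᵘ-homo-* p q = QP.toℚᵘ-injective
    (UP.≃-trans (QP.toℚᵘ-fromℚᵘ (p U.* q))
    (UP.≃-trans (UP.*-cong (UP.≃-sym (QP.toℚᵘ-fromℚᵘ p)) (UP.≃-sym (QP.toℚᵘ-fromℚᵘ q)))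
                (UP.≃-sym (QP.toℚᵘ-homo-* (Q.fromℚᵘ p) (Q.fromℚᵘ q)))))

  /-homo-* : ∀ a b m n .{{_ : ℕ.NonZero m}} .{{_ : ℕ.NonZero n}} →
             (a / m) Q.* (b / n) ≡ ((a ℤ.* b) / (m ℕ.* n)) {{ℕP.m*n≢0 m n}}
  /-homo-* a b (suc m) (suc n) = sym (fromℚᵘ-homo-* (mkℚᵘ a m) (mkℚᵘ b n))

  fromℤ : ℤ → ℚ
  fromℤ a = a / 1

  fromℤ-* : ∀ a b → fromℤ (a ℤ.* b) ≡ fromℤ a Q.* fromℤ b
  fromℤ-* a b = sym (/-homo-* a b 1 1)

  fromℤ-+ : ∀ a b → fromℤ (a ℤ.+ b) ≡ fromℤ a Q.+ fromℤ b
  fromℤ-+ a b = trans (QP.fromℚᵘ-cong {mkℚᵘ (a ℤ.+ b) 0} {mkℚᵘ a 0 U.+ mkℚᵘ b 0} (*≡* same-fraction))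
                   (fromℚᵘ-homo-+ (mkℚᵘ a 0) (mkℚᵘ b 0))
    where
    same-fraction : (a ℤ.+ b) ℤ.* + 1 ≡ (a ℤ.* + 1 ℤ.+ b ℤ.* + 1) ℤ.* + 1
    same-fraction = solve 2 (λ a b → (a :+ b) :* con (+ 1) := (a :* con (+ 1) :+ b :* con (+ 1)) :* con (+ 1)) refl a b

  fromℤ-- : ∀ a b → fromℤ (a ℤ.- b) ≡ fromℤ a Q.- fromℤ b
  fromℤ-- a b = trans (fromℤ-+ a (ℤ.- b)) (cong (fromℤ a Q.+_) fromℤ-neg)
    where
    fromℤ-neg : fromℤ (ℤ.- b) ≡ Q.- fromℤ b
    fromℤ-neg = trans (cong fromℤ (sym (ℤP.-1*i≡-i b)))
             (trans (fromℤ-* -[1+ 0 ] b) (trans (sym (QP.neg-distribˡ-* Q.1ℚ (fromℤ b))) (cong Q.-_ (QP.*-identityˡ (fromℤ b)))))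

  -1/4 : ℚ
  -1/4 = -[1+ 0 ] / 4

  divNeg4Pow-zero : ∀ x → divNeg4Pow x 0 ≡ fromℤ x
  divNeg4Pow-zero x = cong fromℤ (ℤP.*-identityˡ x)

  divNeg4Pow-suc : ∀ x k → divNeg4Pow x (suc k) ≡ -1/4 Q.* divNeg4Pow x k
  divNeg4Pow-suc x k = trans (QP./-cong {{ℕP.m^n≢0 4 (suc k)}} {{ℕP.m*n≢0 4 (4 ℕ.^ k) {{_}} {{ℕP.m^n≢0 4 k}}}} (ℤP.*-assoc -[1+ 0 ] -1ᵏ x) refl)
                             (sym (/-homo-* -[1+ 0 ] (-1ᵏ ℤ.* x) 4 (4 ℕ.^ k) {{_}} {{ℕP.m^n≢0 4 k}}))
    where -1ᵏ = (ℤ.- (+ 1)) ℤ.^ k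

  divNeg4Pow-power : ∀ x k → divNeg4Pow x k ≡ fromℤ x Q.* -1/4 ^ k
  divNeg4Pow-power x zero    = trans (divNeg4Pow-zero x) (sym (QP.*-identityʳ (fromℤ x)))
  divNeg4Pow-power x (suc k) = begin
    divNeg4Pow x (suc k)              ≡⟨ divNeg4Pow-suc x k ⟩
    -1/4 Q.* divNeg4Pow x k           ≡⟨ cong (-1/4 Q.*_) (divNeg4Pow-power x k) ⟩
    -1/4 Q.* (fromℤ x Q.* -1/4 ^ k)       ≡⟨ QS.solve 3 (λ q a p → q QS.:* (a QS.:* p) QS.:= a QS.:* (q QS.:* p)) refl -1/4 (fromℤ x) (-1/4 ^ k) ⟩
    fromℤ x Q.* (-1/4 Q.* -1/4 ^ k)       ∎
    where open ≡-Reasoning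


module GaussianRationals where

  open import Data.Rational as Q using (ℚ; 0ℚ; 1ℚ)
  import Data.Rational.Properties as QP
  open import Data.Rational.Solver using (module +-*-Solver)
  open import Data.Product using (_,_)
  open import Relation.Binary.PropositionalEquality
  open import Relation.Nullary using (Dec; yes; no)
  open import Algebra.Structures using (IsCommutativeRing)
  open +-*-Solver using (solve; _:=_; _:+_; _:*_; _:-_; con)

  infix 5 _+i_
  record ℚi : Set where
    constructor _+i_
    field
      re : ℚ
      im : ℚ
  open ℚi public

  infixl 6 _⊕_
  infixl 7 _⊗_
  _⊕_ : ℚi → ℚi → ℚi
  (a +i b) ⊕ (c +i d) = (a Q.+ c) +i (b Q.+ d)

  _⊗_ : ℚi → ℚi → ℚi
  (a +i b) ⊗ (c +i d) = (a Q.* c Q.- b Q.* d) +i (a Q.* d Q.+ b Q.* c)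

  ⊖_ : ℚi → ℚi
  ⊖ (a +i b) = (Q.- a) +i (Q.- b)

  0i 1i i : ℚi
  0i = 0ℚ +i 0ℚ
  1i = 1ℚ +i 0ℚ
  i  = 0ℚ +i 1ℚ

  ρ : ℚ → ℚi
  ρ r = r +i 0ℚ

  ≡-+i : ∀ {a b c d} → a ≡ c → b ≡ d → (a +i b) ≡ (c +i d)
  ≡-+i = cong₂ _+i_

  ⊕-assoc : ∀ x y z → (x ⊕ y) ⊕ z ≡ x ⊕ (y ⊕ z)
  ⊕-assoc (a +i b) (c +i d) (e +i f) = ≡-+i (QP.+-assoc a c e) (QP.+-assoc b d f)

  ⊕-comm : ∀ x y → x ⊕ y ≡ y ⊕ x
  ⊕-comm (a +i b) (c +i d) = ≡-+i (QP.+-comm a c) (QP.+-comm b d)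

  ⊕-identityˡ : ∀ x → 0i ⊕ x ≡ x
  ⊕-identityˡ (a +i b) = ≡-+i (QP.+-identityˡ a) (QP.+-identityˡ b)

  ⊕-identityʳ : ∀ x → x ⊕ 0i ≡ x
  ⊕-identityʳ (a +i b) = ≡-+i (QP.+-identityʳ a) (QP.+-identityʳ b)

  ⊕-inverseˡ : ∀ x → (⊖ x) ⊕ x ≡ 0i
  ⊕-inverseˡ (a +i b) = ≡-+i (QP.+-inverseˡ a) (QP.+-inverseˡ b)

  ⊕-inverseʳ : ∀ x → x ⊕ (⊖ x) ≡ 0i
  ⊕-inverseʳ (a +i b) = ≡-+i (QP.+-inverseʳ a) (QP.+-inverseʳ b)

  ⊗-assoc : ∀ x y z → (x ⊗ y) ⊗ z ≡ x ⊗ (y ⊗ z)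
  ⊗-assoc (a +i b) (c +i d) (e +i f) = ≡-+i
    (solve 6 (λ a b c d e f → (a :* c :- b :* d) :* e :- (a :* d :+ b :* c) :* f := a :* (c :* e :- d :* f) :- b :* (c :* f :+ d :* e)) refl a b c d e f)
    (solve 6 (λ a b c d e f → (a :* c :- b :* d) :* f :+ (a :* d :+ b :* c) :* e := a :* (c :* f :+ d :* e) :+ b :* (c :* e :- d :* f)) refl a b c d e f)

  ⊗-comm : ∀ x y → x ⊗ y ≡ y ⊗ x
  ⊗-comm (a +i b) (c +i d) = ≡-+i
    (solve 4 (λ a b c d → a :* c :- b :* d := c :* a :- d :* b) refl a b c d)
    (solve 4 (λ a b c d → a :* d :+ b :* c := c :* b :+ d :* a) refl a b c d)

  ⊗-identityˡ : ∀ x → 1i ⊗ x ≡ x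
  ⊗-identityˡ (a +i b) = ≡-+i
    (solve 2 (λ a b → con 1ℚ :* a :- con 0ℚ :* b := a) refl a b)
    (solve 2 (λ a b → con 1ℚ :* b :+ con 0ℚ :* a := b) refl a b)

  ⊗-identityʳ : ∀ x → x ⊗ 1i ≡ x
  ⊗-identityʳ x = trans (⊗-comm x 1i) (⊗-identityˡ x)

  ⊗-distribˡ : ∀ x y z → x ⊗ (y ⊕ z) ≡ x ⊗ y ⊕ x ⊗ z
  ⊗-distribˡ (a +i b) (c +i d) (e +i f) = ≡-+i
    (solve 6 (λ a b c d e f → a :* (c :+ e) :- b :* (d :+ f) := (a :* c :- b :* d) :+ (a :* e :- b :* f)) refl a b c d e f)
    (solve 6 (λ a b c d e f → a :* (d :+ f) :+ b :* (c :+ e) := (a :* d :+ b :* c) :+ (a :* f :+ b :* e)) refl a b c d e f)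

  ⊗-distribʳ : ∀ x y z → (y ⊕ z) ⊗ x ≡ y ⊗ x ⊕ z ⊗ x
  ⊗-distribʳ x y z = trans (⊗-comm (y ⊕ z) x) (trans (⊗-distribˡ x y z) (cong₂ _⊕_ (⊗-comm x y) (⊗-comm x z)))

  isCommutativeRing : IsCommutativeRing _≡_ _⊕_ _⊗_ ⊖_ 0i 1i
  isCommutativeRing = record
    { isRing = record
      { +-isAbelianGroup = record
        { isGroup = record
          { isMonoid = record
            { isSemigroup = record
              { isMagma = record { isEquivalence = isEquivalence ; ∙-cong = cong₂ _⊕_ }
              ; assoc = ⊕-assoc }
            ; identity = ⊕-identityˡ , ⊕-identityʳ }
          ; inverse = ⊕-inverseˡ , ⊕-inverseʳ
          ; ⁻¹-cong = cong ⊖_ }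
        ; comm = ⊕-comm }
      ; *-cong = cong₂ _⊗_
      ; *-assoc = ⊗-assoc
      ; *-identity = ⊗-identityˡ , ⊗-identityʳ
      ; distrib = ⊗-distribˡ , ⊗-distribʳ }
    ; *-comm = ⊗-comm }

  ℚ[i] : CommutativeRing _ _
  ℚ[i] = record { isCommutativeRing = isCommutativeRing }

  _≟_ : (x y : ℚi) → Dec (x ≡ y)
  (a +i b) ≟ (c +i d) with a QP.≟ c | b QP.≟ d
  ... | yes refl | yes refl = yes refl
  ... | no a≢c   | _        = no (λ { refl → a≢c refl })
  ... | yes _    | no b≢d   = no (λ { refl → b≢d refl })

  ρ-* : ∀ a b → ρ a ⊗ ρ b ≡ ρ (a Q.* b)
  ρ-* a b = ≡-+i (QP.+-identityʳ (a Q.* b)) (trans (cong₂ Q._+_ (QP.*-zeroʳ a) (QP.*-zeroˡ b)) refl)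

  ρ-scale : ∀ r a b → ρ r ⊗ (a +i b) ≡ (r Q.* a +i r Q.* b)
  ρ-scale r a b = ≡-+i (solve 3 (λ r a b → r :* a :- con 0ℚ :* b := r :* a) refl r a b)
                       (solve 3 (λ r a b → r :* b :+ con 0ℚ :* a := r :* b) refl r a b)


module LucasPowers where

  open import Defs using (lucasU; lucasV)
  open GaussianRationals
  open IntegersInRationals using (fromℤ; fromℤ-*; fromℤ--)
  open import Data.Nat using (ℕ; zero; suc)
  open import Data.Integer as ℤ using (ℤ; +_)
  open import Data.Rational as Q using (1ℚ; ½)
  open import Data.Rational.Solver using (module +-*-Solver)
  open import Algebra.Properties.Semiring.Exp (CommutativeRing.semiring ℚ[i]) using (_^_)
  import Algebra.Solver.Ring.AlmostCommutativeRing as ACR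
  import Algebra.Solver.Ring.Simple
  open import Relation.Binary.PropositionalEquality
  module ℚ[i]-Solver = Algebra.Solver.Ring.Simple (ACR.fromCommutativeRing ℚ[i]) _≟_

  U V : ℕ → ℤ
  U = lucasU (+ 2) (+ 2)
  V = lucasV (+ 2) (+ 2)

  α : ℚi
  α = 1ℚ +i 1ℚ

  α-characteristic : ∀ w → α ⊗ (α ⊗ w) ≡ ρ (fromℤ (+ 2)) ⊗ (α ⊗ w) ⊕ ⊖ (ρ (fromℤ (+ 2)) ⊗ w)
  α-characteristic w = solve 1 (λ w → con α :* (con α :* w) := con (ρ (fromℤ (+ 2))) :* (con α :* w) :- con (ρ (fromℤ (+ 2))) :* w) refl w
    where open ℚ[i]-Solver

  α-power : ∀ k → α ^ k ≡ (fromℤ (V k) Q.* ½ +i fromℤ (U k))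
  α-power zero          = refl
  α-power (suc zero)    = refl
  α-power (suc (suc k)) = begin
    α ⊗ (α ⊗ α ^ k)                                                ≡⟨ α-characteristic (α ^ k) ⟩
    ρ two ⊗ α ^ suc k ⊕ ⊖ (ρ two ⊗ α ^ k)                          ≡⟨ cong₂ (λ x y → ρ two ⊗ x ⊕ ⊖ (ρ two ⊗ y)) (α-power (suc k)) (α-power k) ⟩
    ρ two ⊗ (v₁ Q.* ½ +i u₁) ⊕ ⊖ (ρ two ⊗ (v₀ Q.* ½ +i u₀))        ≡⟨ cong₂ (λ x y → x ⊕ ⊖ y) (ρ-scale two (v₁ Q.* ½) u₁) (ρ-scale two (v₀ Q.* ½) u₀) ⟩
    (two Q.* (v₁ Q.* ½) Q.- two Q.* (v₀ Q.* ½) +i two Q.* u₁ Q.- two Q.* u₀)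
      ≡⟨ cong (_+i (two Q.* u₁ Q.- two Q.* u₀)) (solve 3 (λ t v w → t :* (v :* con ½) :- t :* (w :* con ½) := (t :* v :- t :* w) :* con ½) refl two v₁ v₀) ⟩
    ((two Q.* v₁ Q.- two Q.* v₀) Q.* ½ +i two Q.* u₁ Q.- two Q.* u₀)  ≡⟨ sym (≡-+i (cong (Q._* ½) (fromℤ-step (V (suc k)) (V k))) (fromℤ-step (U (suc k)) (U k))) ⟩
    (fromℤ (V (suc (suc k))) Q.* ½ +i fromℤ (U (suc (suc k))))        ∎
    where
    open ≡-Reasoning
    open +-*-Solver using (solve; _:=_; _:*_; _:-_; con)
    two = fromℤ (+ 2)
    v₀ = fromℤ (V k)
    v₁ = fromℤ (V (suc k))
    u₀ = fromℤ (U k)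
    u₁ = fromℤ (U (suc k))
    -- both Lucas sequences satisfy xₖ₊₂ = 2xₖ₊₁ − 2xₖ
    fromℤ-step : ∀ a b → fromℤ (+ 2 ℤ.* a ℤ.- + 2 ℤ.* b) ≡ two Q.* fromℤ a Q.- two Q.* fromℤ b
    fromℤ-step a b = trans (fromℤ-- (+ 2 ℤ.* a) (+ 2 ℤ.* b)) (cong₂ Q._-_ (fromℤ-* (+ 2) a) (fromℤ-* (+ 2) b))


module PhaseOfTheSums where

  open GaussianRationals
  open IntegersInRationals using (fromℤ; fromℤ-+; -1/4)
  open LucasPowers using (α)
  open CentralBinomialSums ℚ[i] using (ι; F; recurrence)
  open import Data.Nat as ℕ using (ℕ; zero; suc)
  open import Data.Integer as ℤ using (+_)
  open import Data.Rational as Q using (ℚ; 0ℚ; 1ℚ; ½)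
  import Data.Rational.Properties as QP
  import Data.Rational.Solver
  open import Data.Product using (Σ; _×_; _,_; proj₁)
  open import Algebra.Properties.Semiring.Exp (CommutativeRing.semiring ℚ[i]) using (_^_; ^-assocʳ)
  open import Algebra.Properties.Semiring.Exp (CommutativeRing.semiring QP.+-*-commutativeRing) using () renaming (_^_ to _^ℚ_)
  import Algebra.Solver.Ring.AlmostCommutativeRing as ACR
  import Algebra.Solver.Ring.Simple
  open import Relation.Binary.PropositionalEquality
  module ℚ[i]-Solver = Algebra.Solver.Ring.Simple (ACR.fromCommutativeRing ℚ[i]) _≟_

  z : ℚi
  z = ρ -1/4 ⊗ α

  ω : ℚi
  ω = 1ℚ +i Q.- 1ℚ

  -- The coefficients of the recurrence at z are real multiples of ω and ω²:
  -- 1 + 2z = ω/2 and 1 + 4z = -i = ω²/2.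
  c₂-at-z : 1i ⊕ ι 2 ⊗ z ≡ ω ⊗ ρ ½
  c₂-at-z = refl

  c₄-at-z : 1i ⊕ ι 4 ⊗ z ≡ ω ⊗ ω ⊗ ρ ½
  c₄-at-z = refl

  ι-real : ∀ m → ι m ≡ ρ (fromℤ (+ m))
  ι-real zero    = refl
  ι-real (suc m) = trans (cong (1i ⊕_) (ι-real m)) (cong ρ (sym (fromℤ-+ (+ 1) (+ m))))

  fromℤ[1+m]≢0 : ∀ m → Q.NonZero (fromℤ (+ suc m))
  fromℤ[1+m]≢0 m = QP.pos⇒nonZero (fromℤ (+ suc m)) {{QP.normalize-pos (suc m) 1}}

  1/[1+_] : ℕ → ℚ
  1/[1+ m ] = (Q.1/ fromℤ (+ suc m)) {{fromℤ[1+m]≢0 m}}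

  ι-cancel : ∀ m {w w′} → ι (suc m) ⊗ w ≡ w′ → w ≡ ρ (1/[1+ m ]) ⊗ w′
  ι-cancel m {w} {w′} eq = begin
    w                             ≡⟨ sym (⊗-identityˡ w) ⟩
    1i ⊗ w                        ≡⟨ cong (_⊗ w) (sym inverse) ⟩
    ρ (1/[1+ m ]) ⊗ ι (suc m) ⊗ w  ≡⟨ ⊗-assoc (ρ 1/[1+ m ]) (ι (suc m)) w ⟩
    ρ (1/[1+ m ]) ⊗ (ι (suc m) ⊗ w) ≡⟨ cong (ρ 1/[1+ m ] ⊗_) eq ⟩
    ρ (1/[1+ m ]) ⊗ w′             ∎
    where
    open ≡-Reasoning
    inverse : ρ 1/[1+ m ] ⊗ ι (suc m) ≡ 1i
    inverse = trans (cong (ρ 1/[1+ m ] ⊗_) (ι-real (suc m)))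
              (trans (ρ-* 1/[1+ m ] (fromℤ (+ suc m))) (cong ρ (QP.*-inverseˡ (fromℤ (+ suc m)) {{fromℤ[1+m]≢0 m}})))

  infix 4 _∥_
  _∥_ : ℚi → ℚi → Set
  w ∥ c = Σ ℚ λ r → w ≡ c ⊗ ρ r

  move-right : ∀ {a b c} → a ⊕ b ≡ c → a ≡ c ⊕ ⊖ b
  move-right {a} {b} refl = solve 2 (λ a b → a := (a :+ b) :- b) refl a b
    where open ℚ[i]-Solver

  phase-step : ∀ n → F z n ∥ ω ^ n → F z (suc n) ∥ ω ^ suc n → F z (2 ℕ.+ n) ∥ ω ^ (2 ℕ.+ n)
  phase-step n (r , Fn≡) (s , Fn₁≡) = 1/[1+ suc n ] Q.* t , (begin
    F z n₂                                ≡⟨ ι-cancel (suc n) scaled ⟩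
    ρ 1/[1+ suc n ] ⊗ (ω ^ n₂ ⊗ ρ t)       ≡⟨ solve 3 (λ a w b → a :* (w :* b) := w :* (a :* b)) refl (ρ 1/[1+ suc n ]) (ω ^ n₂) (ρ t) ⟩
    ω ^ n₂ ⊗ (ρ 1/[1+ suc n ] ⊗ ρ t)       ≡⟨ cong (ω ^ n₂ ⊗_) (ρ-* 1/[1+ suc n ] t) ⟩
    ω ^ n₂ ⊗ ρ (1/[1+ suc n ] Q.* t)       ∎)
    where
    open ≡-Reasoning
    open ℚ[i]-Solver
    n₁ = suc n
    n₂ = 2 ℕ.+ n
    n₃ = 3 ℕ.+ 2 ℕ.* n
    e₁ = fromℤ (+ n₁)
    e₃ = fromℤ (+ n₃)
    t = ½ Q.* (e₃ Q.* s Q.- e₁ Q.* r)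
    -- (n+2) Fz(n+2) = (2n+3)(ω/2) Fz(n+1) − (n+1)(ω²/2) Fz(n)
    scaled : ι n₂ ⊗ F z n₂ ≡ ω ^ n₂ ⊗ ρ t
    scaled = begin
      ι n₂ ⊗ F z n₂
        ≡⟨ move-right (recurrence z n) ⟩
      ι n₃ ⊗ (1i ⊕ ι 2 ⊗ z) ⊗ F z n₁ ⊕ ⊖ (ι n₁ ⊗ (1i ⊕ ι 4 ⊗ z) ⊗ F z n)
        ≡⟨ cong₂ (λ c₂ c₄ → ι n₃ ⊗ c₂ ⊗ F z n₁ ⊕ ⊖ (ι n₁ ⊗ c₄ ⊗ F z n)) c₂-at-z c₄-at-z ⟩
      ι n₃ ⊗ (ω ⊗ ρ ½) ⊗ F z n₁ ⊕ ⊖ (ι n₁ ⊗ (ω ⊗ ω ⊗ ρ ½) ⊗ F z n)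
        ≡⟨ cong₂ (λ u v → u ⊗ (ω ⊗ ρ ½) ⊗ F z n₁ ⊕ ⊖ (v ⊗ (ω ⊗ ω ⊗ ρ ½) ⊗ F z n)) (ι-real n₃) (ι-real n₁) ⟩
      ρ e₃ ⊗ (ω ⊗ ρ ½) ⊗ F z n₁ ⊕ ⊖ (ρ e₁ ⊗ (ω ⊗ ω ⊗ ρ ½) ⊗ F z n)
        ≡⟨ cong₂ (λ u v → ρ e₃ ⊗ (ω ⊗ ρ ½) ⊗ u ⊕ ⊖ (ρ e₁ ⊗ (ω ⊗ ω ⊗ ρ ½) ⊗ v)) Fn₁≡ Fn≡ ⟩
      ρ e₃ ⊗ (ω ⊗ ρ ½) ⊗ (ω ⊗ ω ^ n ⊗ ρ s) ⊕ ⊖ (ρ e₁ ⊗ (ω ⊗ ω ⊗ ρ ½) ⊗ (ω ^ n ⊗ ρ r))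
        ≡⟨ solve 7 (λ a h w p s b r → a :* (w :* h) :* (w :* p :* s) :- b :* (w :* w :* h) :* (p :* r)
                                   := w :* (w :* p) :* (h :* (a :* s :- b :* r)))
                   refl (ρ e₃) (ρ ½) ω (ω ^ n) (ρ s) (ρ e₁) (ρ r) ⟩
      ω ^ n₂ ⊗ (ρ ½ ⊗ (ρ e₃ ⊗ ρ s ⊕ ⊖ (ρ e₁ ⊗ ρ r)))
        ≡⟨ cong (λ u → ω ^ n₂ ⊗ (ρ ½ ⊗ u)) (cong₂ (λ u v → u ⊕ ⊖ v) (ρ-* e₃ s) (ρ-* e₁ r)) ⟩
      ω ^ n₂ ⊗ (ρ ½ ⊗ ρ (e₃ Q.* s Q.- e₁ Q.* r))
        ≡⟨ cong (ω ^ n₂ ⊗_) (ρ-* ½ (e₃ Q.* s Q.- e₁ Q.* r)) ⟩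
      ω ^ n₂ ⊗ ρ t
        ∎

  phase : ∀ n → F z n ∥ ω ^ n
  phase n = proj₁ (consecutive n)
    where
    consecutive : ∀ n → F z n ∥ ω ^ n × F z (suc n) ∥ ω ^ suc n
    consecutive zero    = (1ℚ , refl) , (½ , refl)
    consecutive (suc n) = let (p , q) = consecutive n in q , phase-step n p q

  ρ-^ : ∀ a j → ρ a ^ j ≡ ρ (a ^ℚ j)
  ρ-^ a zero    = refl
  ρ-^ a (suc j) = trans (cong (ρ a ⊗_) (ρ-^ a j)) (ρ-* a (a ^ℚ j))

  -- ω⁴ = -4, hence ω⁴ʲ = (-4)ʲ is real.
  ω^[4j] : ∀ j → ω ^ (4 ℕ.* j) ≡ ρ (fromℤ (ℤ.- + 4) ^ℚ j)
  ω^[4j] j = trans (sym (^-assocʳ ω 4 j)) (ρ-^ (fromℤ (ℤ.- + 4)) j)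

  re-imaginary⊗real : ∀ b x → re ((0ℚ +i b) ⊗ ρ x) ≡ 0ℚ
  re-imaginary⊗real b x = solve 2 (λ b x → con 0ℚ :* x :- b :* con 0ℚ := con 0ℚ) refl b x
    where open Data.Rational.Solver.+-*-Solver

  F-real : ∀ j → im (F z (4 ℕ.* j)) ≡ 0ℚ
  F-real j = on-real-line (phase (4 ℕ.* j))
    where
    on-real-line : F z (4 ℕ.* j) ∥ ω ^ (4 ℕ.* j) → im (F z (4 ℕ.* j)) ≡ 0ℚ
    on-real-line (r , eq) = cong im (trans eq (trans (cong (_⊗ ρ r) (ω^[4j] j)) (ρ-* (fromℤ (ℤ.- + 4) ^ℚ j) r)))

  -- Fz(4j+2) is purely imaginary, since ω² = -2i.
  F-imaginary : ∀ j → re (F z (2 ℕ.+ 4 ℕ.* j)) ≡ 0ℚ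
  F-imaginary j = on-imaginary-line (phase (2 ℕ.+ 4 ℕ.* j))
    where
    a = fromℤ (ℤ.- + 4) ^ℚ j
    on-imaginary-line : F z (2 ℕ.+ 4 ℕ.* j) ∥ ω ^ (2 ℕ.+ 4 ℕ.* j) → re (F z (2 ℕ.+ 4 ℕ.* j)) ≡ 0ℚ
    on-imaginary-line (r , eq) = trans (cong re (begin
      F z (2 ℕ.+ 4 ℕ.* j)            ≡⟨ eq ⟩
      ω ⊗ (ω ⊗ ω ^ (4 ℕ.* j)) ⊗ ρ r  ≡⟨ cong (λ u → ω ⊗ (ω ⊗ u) ⊗ ρ r) (ω^[4j] j) ⟩
      ω ⊗ (ω ⊗ ρ a) ⊗ ρ r            ≡⟨ solve 3 (λ w a r → w :* (w :* a) :* r := (w :* w) :* (a :* r)) refl ω (ρ a) (ρ r) ⟩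
      ω ⊗ ω ⊗ (ρ a ⊗ ρ r)            ≡⟨ cong (ω ⊗ ω ⊗_) (ρ-* a r) ⟩
      ω ⊗ ω ⊗ ρ (a Q.* r)            ∎))
      (re-imaginary⊗real (Q.- (fromℤ (+ 2))) (a Q.* r))
      where
      open ≡-Reasoning
      open ℚ[i]-Solver


module LucasSummands where

  open import Defs using (sumTo; divNeg4Pow)
  open GaussianRationals
  open IntegersInRationals using (fromℤ; fromℤ-*; -1/4; divNeg4Pow-power)
  open LucasPowers using (α; α-power; U; V)
  open CentralBinomialSums ℚ[i] using (ι; Σ≤; T; F)
  open PhaseOfTheSums using (z; ι-real; ρ-^; F-real; F-imaginary)
  open Binomial using (central)
  open import Data.Nat as ℕ using (ℕ; zero; suc)
  open import Data.Nat.Combinatorics using (_C_)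
  open import Data.Integer as ℤ using (+_)
  open import Data.Rational as Q using (½)
  import Data.Rational.Properties as QP
  open import Data.Rational.Solver using (module +-*-Solver)
  open import Algebra.Properties.CommutativeSemiring.Exp (CommutativeRing.commutativeSemiring ℚ[i]) using (_^_; ^-distrib-*)
  open import Algebra.Properties.Semiring.Exp (CommutativeRing.semiring QP.+-*-commutativeRing) using () renaming (_^_ to _^ℚ_)
  import Algebra.Solver.Ring.AlmostCommutativeRing as ACR
  import Algebra.Solver.Ring.Simple
  open import Relation.Binary.PropositionalEquality
  module ℚ[i]-Solver = Algebra.Solver.Ring.Simple (ACR.fromCommutativeRing ℚ[i]) _≟_

  summand : ℕ → ℕ → ℚi
  summand n k = ι (n C k) ⊗ T z k

  summand-components : ∀ n k → let m = fromℤ (+ (n C k)) Q.* fromℤ (+ central k) Q.* -1/4 ^ℚ k in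
    summand n k ≡ (m Q.* (fromℤ (V k) Q.* ½) +i m Q.* fromℤ (U k))
  summand-components n k = begin
    ι (n C k) ⊗ (ι (central k) ⊗ (ρ -1/4 ⊗ α) ^ k)
      ≡⟨ cong₂ (λ a b → a ⊗ (b ⊗ (ρ -1/4 ⊗ α) ^ k)) (ι-real (n C k)) (ι-real (central k)) ⟩
    ρ a ⊗ (ρ c ⊗ (ρ -1/4 ⊗ α) ^ k)
      ≡⟨ cong (λ u → ρ a ⊗ (ρ c ⊗ u)) (trans (^-distrib-* (ρ -1/4) α k) (cong (_⊗ α ^ k) (ρ-^ -1/4 k))) ⟩
    ρ a ⊗ (ρ c ⊗ (ρ (-1/4 ^ℚ k) ⊗ α ^ k))
      ≡⟨ solve 4 (λ a c q w → a :* (c :* (q :* w)) := (a :* c :* q) :* w) refl (ρ a) (ρ c) (ρ (-1/4 ^ℚ k)) (α ^ k) ⟩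
    ρ a ⊗ ρ c ⊗ ρ (-1/4 ^ℚ k) ⊗ α ^ k
      ≡⟨ cong (_⊗ α ^ k) (trans (cong (_⊗ ρ (-1/4 ^ℚ k)) (ρ-* a c)) (ρ-* (a Q.* c) (-1/4 ^ℚ k))) ⟩
    ρ m ⊗ α ^ k
      ≡⟨ cong (ρ m ⊗_) (α-power k) ⟩
    ρ m ⊗ (fromℤ (V k) Q.* ½ +i fromℤ (U k))
      ≡⟨ ρ-scale m (fromℤ (V k) Q.* ½) (fromℤ (U k)) ⟩
    (m Q.* (fromℤ (V k) Q.* ½) +i m Q.* fromℤ (U k))
      ∎
    where
    open ≡-Reasoning
    open ℚ[i]-Solver
    a = fromℤ (+ (n C k))
    c = fromℤ (+ central k)
    m = a Q.* c Q.* -1/4 ^ℚ k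

  divNeg4Pow-summand : ∀ n k w → divNeg4Pow (+ (n C k) ℤ.* + central k ℤ.* w) k
                                ≡ fromℤ (+ (n C k)) Q.* fromℤ (+ central k) Q.* -1/4 ^ℚ k Q.* fromℤ w
  divNeg4Pow-summand n k w = begin
    divNeg4Pow (+ (n C k) ℤ.* + central k ℤ.* w) k
      ≡⟨ divNeg4Pow-power (+ (n C k) ℤ.* + central k ℤ.* w) k ⟩
    fromℤ (+ (n C k) ℤ.* + central k ℤ.* w) Q.* q
      ≡⟨ cong (Q._* q) (trans (fromℤ-* (+ (n C k) ℤ.* + central k) w) (cong (Q._* fromℤ w) (fromℤ-* (+ (n C k)) (+ central k)))) ⟩
    fromℤ (+ (n C k)) Q.* fromℤ (+ central k) Q.* fromℤ w Q.* q
      ≡⟨ solve 4 (λ a c w q → a :* c :* w :* q := a :* c :* q :* w) refl (fromℤ (+ (n C k))) (fromℤ (+ central k)) (fromℤ w) q ⟩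
    fromℤ (+ (n C k)) Q.* fromℤ (+ central k) Q.* q Q.* fromℤ w
      ∎
    where
    open ≡-Reasoning
    open +-*-Solver
    q = -1/4 ^ℚ k

  im-summand : ∀ n k → im (summand n k) ≡ divNeg4Pow (+ (n C k) ℤ.* + central k ℤ.* U k) k
  im-summand n k = trans (cong im (summand-components n k)) (sym (divNeg4Pow-summand n k (U k)))

  re-summand : ∀ n k → re (summand n k) Q.+ re (summand n k) ≡ divNeg4Pow (+ (n C k) ℤ.* + central k ℤ.* V k) k
  re-summand n k = begin
    re (summand n k) Q.+ re (summand n k)             ≡⟨ cong (λ x → re x Q.+ re x) (summand-components n k) ⟩
    m Q.* (fromℤ (V k) Q.* ½) Q.+ m Q.* (fromℤ (V k) Q.* ½)  ≡⟨ solve 2 (λ m v → m :* (v :* con ½) :+ m :* (v :* con ½) := m :* v) refl m (fromℤ (V k)) ⟩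
    m Q.* fromℤ (V k)                                 ≡⟨ sym (divNeg4Pow-summand n k (V k)) ⟩
    divNeg4Pow (+ (n C k) ℤ.* + central k ℤ.* V k) k  ∎
    where
    open ≡-Reasoning
    open +-*-Solver
    m = fromℤ (+ (n C k)) Q.* fromℤ (+ central k) Q.* -1/4 ^ℚ k

  sumTo-cong : ∀ n {f g} → (∀ k → f k ≡ g k) → sumTo n f ≡ sumTo n g
  sumTo-cong zero    f≡g = f≡g 0
  sumTo-cong (suc n) f≡g = cong₂ Q._+_ (sumTo-cong n f≡g) (f≡g (suc n))

  sumTo-double : ∀ n f → sumTo n (λ k → f k Q.+ f k) ≡ sumTo n f Q.+ sumTo n f
  sumTo-double zero    f = refl
  sumTo-double (suc n) f = trans (cong (Q._+ (f (suc n) Q.+ f (suc n))) (sumTo-double n f))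
    (solve 2 (λ a b → (a :+ a) :+ (b :+ b) := (a :+ b) :+ (a :+ b)) refl (sumTo n f) (f (suc n)))
    where open +-*-Solver

  re-Σ≤ : ∀ n f → re (Σ≤ n f) ≡ sumTo n (λ k → re (f k))
  re-Σ≤ zero    f = refl
  re-Σ≤ (suc n) f = cong (Q._+ re (f (suc n))) (re-Σ≤ n f)

  im-Σ≤ : ∀ n f → im (Σ≤ n f) ≡ sumTo n (λ k → im (f k))
  im-Σ≤ zero    f = refl
  im-Σ≤ (suc n) f = cong (Q._+ im (f (suc n))) (im-Σ≤ n f)

  u-sum : ∀ n → sumTo n (λ k → divNeg4Pow (+ (n C k) ℤ.* + central k ℤ.* U k) k) ≡ im (F z n)
  u-sum n = trans (sumTo-cong n (λ k → sym (im-summand n k))) (sym (im-Σ≤ n (summand n)))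

  v-sum : ∀ n → sumTo n (λ k → divNeg4Pow (+ (n C k) ℤ.* + central k ℤ.* V k) k) ≡ re (F z n) Q.+ re (F z n)
  v-sum n = begin
    sumTo n (λ k → divNeg4Pow (+ (n C k) ℤ.* + central k ℤ.* V k) k)  ≡⟨ sumTo-cong n (λ k → sym (re-summand n k)) ⟩
    sumTo n (λ k → re (summand n k) Q.+ re (summand n k))              ≡⟨ sumTo-double n (λ k → re (summand n k)) ⟩
    sumTo n (λ k → re (summand n k)) Q.+ sumTo n (λ k → re (summand n k)) ≡⟨ cong (λ x → x Q.+ x) (sym (re-Σ≤ n (summand n))) ⟩
    re (F z n) Q.+ re (F z n)                                          ∎
    where open ≡-Reasoning

  u-sum-vanishes : ∀ n j → n ≡ 4 ℕ.* j → sumTo n (λ k → divNeg4Pow (+ (n C k) ℤ.* + central k ℤ.* U k) k) ≡ Q.0ℚ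
  u-sum-vanishes n j n≡4j = trans (u-sum n) (trans (cong (λ m → im (F z m)) n≡4j) (F-real j))

  v-sum-vanishes : ∀ n j → n ≡ 2 ℕ.+ 4 ℕ.* j → sumTo n (λ k → divNeg4Pow (+ (n C k) ℤ.* + central k ℤ.* V k) k) ≡ Q.0ℚ
  v-sum-vanishes n j n≡4j+2 = trans (v-sum n) (trans (cong (λ m → re (F z m) Q.+ re (F z m)) n≡4j+2)
                                                     (cong (λ x → x Q.+ x) (F-imaginary j)))


open import Defs
open import Data.Nat as ℕ using (ℕ; _%_)
open import Data.Nat.Divisibility using (_∣_; divides)
open import Data.Nat.DivMod using (_/_; m≡m%n+[m/n]*n)
import Data.Nat.Properties as ℕP
open import Data.Nat.Combinatorics using (_C_)
open import Data.Integer using (+_; _*_)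
open import Data.Rational using (0ℚ)
open import Data.Product using (_×_; _,_)
open import Relation.Binary.PropositionalEquality using (_≡_; trans; cong₂)
open LucasSummands using (u-sum-vanishes; v-sum-vanishes)

theorem1p5 : (n : ℕ) →
    (4 ∣ n → sumTo n (λ k → divNeg4Pow (+ (n C k) * + ((2 ℕ.* k) C k) * lucasU (+ 2) (+ 2) k) k) ≡ 0ℚ)
    × (n % 4 ≡ 2 → sumTo n (λ k → divNeg4Pow (+ (n C k) * + ((2 ℕ.* k) C k) * lucasV (+ 2) (+ 2) k) k) ≡ 0ℚ)
theorem1p5 n = part-a , part-b
  where
  part-a : 4 ∣ n → _
  part-a (divides j n≡j*4) = u-sum-vanishes n j (trans n≡j*4 (ℕP.*-comm j 4))
  part-b : n % 4 ≡ 2 → _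
  part-b n%4≡2 = v-sum-vanishes n (n / 4)
    (trans (m≡m%n+[m/n]*n n 4) (cong₂ ℕ._+_ n%4≡2 (ℕP.*-comm (n / 4) 4)))
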